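{- Let $D$ be the degree sequence of a tree and let $\mathbb{T}_D$ be the set of all trees with degree sequence $D$. Let $T\in\mathbb{T}_D$ satisfy $\mathrm{SO}(T)=\max\{\mathrm{SO}(T''):T''\in\mathbb{T}_D\}$. Then for every choice of a root of $T$ (a vertex or an edge), every level $i$, and every two vertices $p,q$ at level $i$ with $\deg(p)>\deg(q)$, every child $a$ of $p$ and every child $b$ of $q$ satisfy $\deg(a)\le\deg(b)$ (equivalently, $\max_j\deg(\text{children of }p)\le\min_j\deg(\text{children of }q)$).
   Context: For a graph $G$, the Sombor index is $\mathrm{SO}(G)=\sum_{uv\in E(G)}\sqrt{\deg_G(u)^2+\deg_G(v)^2}$. Rooting a tree at a vertex $r$: level $i$ consists of the vertices at distance $i-1$ from $r$, and the children of $x$ are its neighbours at the next level. Rooting at an edge $r_1r_2$: level $i$ consists of vertices at distance $i-1$ from the set $\{r_1,r_2\}$ (so level 1 is $\{r_1,r_2\}$), and the children of $x$ are its neighbours at the next level. -}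

module Defs where

open import Data.Nat using (ℕ; zero; suc; _+_; _*_; _≤_; _<_; _≤ᵇ_; _<ᵇ_)
open import Data.Bool using (Bool; true; false; if_then_else_)
open import Data.Fin using (Fin; toℕ)
open import Data.List using (List; []; _∷_; length; map; allFin; concatMap; filterᵇ)
open import Data.Nat.ListAction using (sum)
open import Data.List.Relation.Unary.Unique.Propositional using (Unique)
open import Data.List.Relation.Binary.Permutation.Propositional using (_↭_)
open import Data.Product using (Σ; _×_; _,_)
open import Data.Sum using (_⊎_)
open import Relation.Binary.PropositionalEquality using (_≡_)

record Graph (n : ℕ) : Set where
  field
    adj    : Fin n → Fin n → Bool
    sym    : ∀ i j → adj i j ≡ adj j i
    irrefl : ∀ i → adj i i ≡ false
open Graph public

module _ {n : ℕ} (G : Graph n) where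

  data Walk : Fin n → Fin n → List (Fin n) → Set where
    here : ∀ {u} → Walk u u (u ∷ [])
    step : ∀ {u w v xs} → adj G u w ≡ true → Walk w v xs → Walk u v (u ∷ xs)

  IsPath : Fin n → Fin n → List (Fin n) → Set
  IsPath u v xs = Walk u v xs × Unique xs

  IsTree : Set
  IsTree = (0 < n)
         × (∀ u v → Σ (List (Fin n)) (λ xs → IsPath u v xs))
         × (∀ u v xs ys → IsPath u v xs → IsPath u v ys → xs ≡ ys)

  deg : Fin n → ℕ
  deg v = length (filterᵇ (adj G v) (allFin n))

  -- degree sequence (as a list indexed by vertices; compared up to permutation)
  degSeq : List ℕ
  degSeq = map deg (allFin n)

  -- Dist u v d : the distance from u to v is d (shortest walk has d edges).
  Dist : Fin n → Fin n → ℕ → Set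
  Dist u v d = Σ (List (Fin n)) (λ xs → Walk u v xs × length xs ≡ suc d)
             × (∀ xs → Walk u v xs → suc d ≤ length xs)

  edges : List (Fin n × Fin n)
  edges = concatMap (λ i → map (λ j → i , j)
            (filterᵇ (λ j → (toℕ i <ᵇ toℕ j) ∧' adj G i j) (allFin n))) (allFin n)
    where
      _∧'_ : Bool → Bool → Bool
      true ∧' b = b
      false ∧' b = false

  -- the radicands deg(u)^2 + deg(v)^2 of the Sombor index, one per edge
  somborTerms : List ℕ
  somborTerms = map (λ e → deg (Data.Product.proj₁ e) * deg (Data.Product.proj₁ e)
                          + deg (Data.Product.proj₂ e) * deg (Data.Product.proj₂ e)) edges

  data Root : Set where
    vertexRoot : Fin n → Root
    edgeRoot   : (r₁ r₂ : Fin n) → adj G r₁ r₂ ≡ true → Root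

  -- RootDist ρ x d : x lies at level d+1 for the root ρ, i.e. its distance
  -- to the root vertex / to the set {r1, r2} is d.
  RootDist : Root → Fin n → ℕ → Set
  RootDist (vertexRoot r) x d = Dist r x d
  RootDist (edgeRoot r₁ r₂ _) x d =
      (Dist r₁ x d × (∀ d' → Dist r₂ x d' → d ≤ d'))
    ⊎ (Dist r₂ x d × (∀ d' → Dist r₁ x d' → d ≤ d'))

isqrtAux : ℕ → ℕ → ℕ
isqrtAux zero    m = 0
isqrtAux (suc k) m = if suc k * suc k ≤ᵇ m then suc k else isqrtAux k m

isqrt : ℕ → ℕ
isqrt m = isqrtAux m m

scaledFloorSum : ℕ → List ℕ → ℕ
scaledFloorSum N as = sum (map (λ a → isqrt (N * N * a)) as)

-- SqrtSumLe as bs  ⇔  Σ √a  ≤  Σ √b   (exact real comparison)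
SqrtSumLe : List ℕ → List ℕ → Set
SqrtSumLe as bs = ∀ N → scaledFloorSum N as ≤ scaledFloorSum N bs + length bs

SOle : ∀ {n m} → Graph n → Graph m → Set
SOle G H = SqrtSumLe (somborTerms G) (somborTerms H)

-- If deg p > deg q while a child a of p has larger degree than a child b of q, replace the edges
-- pa, qb by pb, qa.  Every degree is unchanged, and the result is again a tree: a and b lie strictly
-- deeper than p and q, so after re-attaching a to q and b to p the parent function still strictly
-- decreases a rank, and a graph with such a parent function is a tree.  (For an edge root r₁r₂ the
-- rank 2·height r₁ + height r₂ both decreases along the r₁-parent and separates consecutive levels.)
-- But SO strictly increases, as √(x² + y²) is strictly submodular:
-- √(P² + B²) + √(Q² + A²) > √(P² + A²) + √(Q² + B²) for P > Q, A > B.  Since SO is compared through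
-- floor sums Σ ⌊N √t⌋, this strict inequality is made effective by an explicit choice of the scale N.
module Submission where

open import Defs hiding (sym)
open import Data.Nat using (ℕ; zero; suc; _+_; _*_; _≤_; _<_; z≤n; s≤s; _≤?_; _<?_; _<ᵇ_; _≤ᵇ_)
open import Data.Nat.Properties
open import Data.Nat.Tactic.RingSolver using (solve-∀)
open import Algebra.Properties.CommutativeMonoid.Sum +-0-commutativeMonoid
  using (sum-remove; sum-cong-≗; sum-syntax)
open import Algebra.Properties.CommutativeSemigroup +-commutativeSemigroup using (xy∙z≈xz∙y)
import Algebra.Properties.CommutativeSemigroup *-commutativeSemigroup as *-Semigroup
open import Data.Bool using (Bool; true; false; if_then_else_; _∧_; T)
open import Data.Fin using (Fin; toℕ) renaming (_≟_ to _≟ᶠ_)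
import Data.Fin as Fin
open import Data.Fin.Properties using (punchInᵢ≢i; toℕ-injective)
open import Data.List using (List; []; _∷_; _++_; length; map; concatMap; filterᵇ; tabulate; allFin)
open import Data.List.Properties using (∷-injectiveʳ; map-++; map-∘; map-cong)
open import Data.List.Relation.Binary.Permutation.Propositional using (_↭_; ↭-reflexive)
open import Data.Nat.ListAction using () renaming (sum to sumˡ)
open import Data.Nat.ListAction.Properties using (sum-++)
open import Data.List.Membership.Propositional using (_∈_; _∉_)
open import Data.List.Relation.Unary.Any using (here; there)
open import Data.List.Relation.Unary.All.Properties using (¬Any⇒All¬; All¬⇒¬Any)
open import Data.List.Relation.Unary.AllPairs using ([]; _∷_)
open import Data.List.Relation.Unary.All using ([])
open import Data.List.Relation.Unary.Unique.Propositional using (Unique)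
open import Data.Product using (Σ; ∃; _×_; _,_; proj₁; proj₂)
open import Data.Sum using (_⊎_; inj₁; inj₂)
open import Data.Empty using (⊥; ⊥-elim)
open import Function using (_∘_; id)
open import Relation.Nullary using (¬_; yes; no; Dec; does)
open import Relation.Binary.Definitions using (tri<; tri≈; tri>)
open import Relation.Nullary.Decidable using (_×-dec_; _⊎-dec_; dec-true; dec-false)
open import Relation.Binary.PropositionalEquality
  using (_≡_; _≢_; refl; sym; trans; cong; cong₂; subst; subst₂; module ≡-Reasoning)

-- Walks and paths

module _ {n : ℕ} (G : Graph n) where
  open import Data.List.Membership.DecPropositional (_≟ᶠ_ {n}) using (_∈?_)

  adj-sym : ∀ {x y} → adj G x y ≡ true → adj G y x ≡ true
  adj-sym {x} {y} = trans (Graph.sym G y x)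

  adj⇒≢ : ∀ {x y} → adj G x y ≡ true → x ≢ y
  adj⇒≢ {x} e refl with () ← trans (sym e) (Graph.irrefl G x)

  Walk-head∈ : ∀ {u v xs} → Walk G u v xs → u ∈ xs
  Walk-head∈ here       = here refl
  Walk-head∈ (step _ _) = here refl

  Walk-last∈ : ∀ {u v xs} → Walk G u v xs → v ∈ xs
  Walk-last∈ here       = here refl
  Walk-last∈ (step _ w) = there (Walk-last∈ w)

  Walk-nonempty : ∀ {u v} → ¬ Walk G u v []
  Walk-nonempty ()

  Walk-sources-agree : ∀ {u u′ v v′ xs} → Walk G u v xs → Walk G u′ v′ xs → u ≡ u′
  Walk-sources-agree here       here       = refl
  Walk-sources-agree here       (step _ _) = refl
  Walk-sources-agree (step _ _) here       = refl
  Walk-sources-agree (step _ _) (step _ _) = refl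

  Walk-++ : ∀ {u w v xs ys} → Walk G u w xs → Walk G w v ys → ∃ (Walk G u v)
  Walk-++ here       q = _ , q
  Walk-++ (step e p) q = _ , step e (proj₂ (Walk-++ p q))

  Walk-reverseOnto : ∀ {u v s xs acc} → Walk G u v xs → Walk G u s acc
                   → Σ (List (Fin n)) λ ys → Walk G v s ys × length ys + 1 ≡ length xs + length acc
  Walk-reverseOnto {acc = acc} here a = acc , a , +-comm (length acc) 1
  Walk-reverseOnto {xs = _ ∷ xs} {acc = acc} (step e p) a =
    let ys , q , l = Walk-reverseOnto p (step (adj-sym e) a) in ys , q , trans l (+-suc (length xs) (length acc))

  Walk-reverse : ∀ {u v xs} → Walk G u v xs → Σ (List (Fin n)) λ ys → Walk G v u ys × length ys ≡ length xs
  Walk-reverse p = let ys , q , l = Walk-reverseOnto p here in ys , q , +-cancelʳ-≡ _ _ _ l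

  Path-suffix : ∀ {w v ys u} → Walk G w v ys → Unique ys → u ∈ ys
              → Σ (List (Fin n)) λ zs → IsPath G u v zs × length zs ≤ length ys
  Path-suffix here       uq (here refl) = _ , (here , uq) , ≤-refl
  Path-suffix (step e p) uq (here refl) = _ , (step e p , uq) , ≤-refl
  Path-suffix (step e p) (_ ∷ uq) (there m) with Path-suffix p uq m
  ... | zs , path , l = zs , path , m≤n⇒m≤1+n l

  Walk⇒Path : ∀ {u v xs} → Walk G u v xs → Σ (List (Fin n)) λ ys → IsPath G u v ys × length ys ≤ length xs
  Walk⇒Path here = _ , (here , [] ∷ []) , ≤-refl
  Walk⇒Path {u} (step e p) with Walk⇒Path p
  ... | ys , (q , uq) , l with u ∈? ys
  ...   | yes m = let zs , path , l′ = Path-suffix q uq m in zs , path , ≤-trans l′ (m≤n⇒m≤1+n l)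
  ...   | no ∉ys = u ∷ ys , (step e q , ¬Any⇒All¬ ys ∉ys ∷ uq) , s≤s l

  Walk-length-Lipschitz : (f : Fin n → ℕ) → (∀ x y → adj G x y ≡ true → f y ≤ suc (f x))
                        → ∀ {u v xs} → Walk G u v xs → suc (f v) ≤ f u + length xs
  Walk-length-Lipschitz f lip {u} here = ≤-reflexive (+-comm 1 (f u))
  Walk-length-Lipschitz f lip {u} (step {w = w} {xs = xs} e p) = begin
    suc (f _)            ≤⟨ Walk-length-Lipschitz f lip p ⟩
    f w + length xs      ≤⟨ +-monoˡ-≤ (length xs) (lip u w e) ⟩
    suc (f u) + length xs ≡⟨ sym (+-suc (f u) (length xs)) ⟩
    f u + suc (length xs) ∎
    where open ≤-Reasoning

-- Parent structures

-- rank need not be the depth: any potential that strictly decreases towards the root will do.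
record ParentStructure {n : ℕ} (G : Graph n) : Set where
  field
    root        : Fin n
    parent      : Fin n → Fin n
    rank        : Fin n → ℕ
    rank-parent : ∀ x → x ≢ root → rank (parent x) < rank x
    adj-parent  : ∀ x → x ≢ root → adj G x (parent x) ≡ true
    adj⇒parent  : ∀ {x y} → adj G x y ≡ true → (x ≢ root × parent x ≡ y) ⊎ (y ≢ root × parent y ≡ x)

module ParentStructureProperties {n : ℕ} {G : Graph n} (S : ParentStructure G) where
  open ParentStructure S

  adj-rank<⇒parent : ∀ {x y} → adj G x y ≡ true → rank x < rank y → y ≢ root × parent y ≡ x
  adj-rank<⇒parent {x} e x<y with adj⇒parent e
  ... | inj₁ (x≢root , refl) = ⊥-elim (<-asym x<y (rank-parent x x≢root))
  ... | inj₂ child = child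

  walkToRoot : ∀ k x → rank x < k → ∃ (Walk G x root)
  walkToRoot (suc k) x (s≤s x<k) with x ≟ᶠ root
  ... | yes refl = _ , here
  ... | no x≢root =
    _ , step (adj-parent x x≢root) (proj₂ (walkToRoot k (parent x) (≤-trans (rank-parent x x≢root) x<k)))

  data Ancestor (w : Fin n) : Fin n → Set where
    self : Ancestor w w
    up   : ∀ {x} → x ≢ root → Ancestor w (parent x) → Ancestor w x

  Ancestor⇒rank : ∀ {w x} → Ancestor w x → w ≡ x ⊎ rank w < rank x
  Ancestor⇒rank self = inj₁ refl
  Ancestor⇒rank {w} {x} (up x≢root anc) with Ancestor⇒rank anc
  ... | inj₁ refl = inj₂ (rank-parent x x≢root)
  ... | inj₂ w<px = inj₂ (<-trans w<px (rank-parent x x≢root))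

  ¬Ancestor-parent : ∀ {x} → x ≢ root → ¬ Ancestor x (parent x)
  ¬Ancestor-parent {x} x≢root anc with Ancestor⇒rank anc
  ... | inj₁ x≡px = <-irrefl (cong rank (sym x≡px)) (rank-parent x x≢root)
  ... | inj₂ x<px = <-asym x<px (rank-parent x x≢root)

  Ancestor-parent : ∀ {w v} → w ≢ root → Ancestor w v → Ancestor (parent w) v
  Ancestor-parent w≢root self          = up w≢root self
  Ancestor-parent w≢root (up x≢root anc) = up x≢root (Ancestor-parent w≢root anc)

  Ancestor-total : ∀ {a b v} → Ancestor a v → Ancestor b v → Ancestor a b ⊎ Ancestor b a
  Ancestor-total self            b⊑v             = inj₂ b⊑v
  Ancestor-total (up x≢root a⊑v) self            = inj₁ (up x≢root a⊑v)
  Ancestor-total (up _ a⊑v)      (up _ b⊑v)      = Ancestor-total a⊑v b⊑v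

  walk-stays-in-subtree : ∀ {u x v xs} → Walk G x v xs → Ancestor u x → parent u ∉ xs → Ancestor u v
  walk-stays-in-subtree here anc _ = anc
  walk-stays-in-subtree (step e p) anc ∉xs with adj⇒parent e
  ... | inj₂ (y≢root , refl) = walk-stays-in-subtree p (up y≢root anc) (∉xs ∘ there)
  walk-stays-in-subtree (step e p) self ∉xs | inj₁ (_ , refl) = ⊥-elim (∉xs (there (Walk-head∈ G p)))
  walk-stays-in-subtree (step e p) (up _ anc) ∉xs | inj₁ (_ , refl) = walk-stays-in-subtree p anc (∉xs ∘ there)

  walk-stays-out-of-subtree : ∀ {u x v xs} → Walk G x v xs → ¬ Ancestor u x → u ∉ xs → ¬ Ancestor u v
  walk-stays-out-of-subtree here ¬anc _ = ¬anc
  walk-stays-out-of-subtree {u} (step {w = y} e p) ¬anc ∉xs with adj⇒parent e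
  ... | inj₁ (x≢root , refl) = walk-stays-out-of-subtree p (¬anc ∘ up x≢root) (∉xs ∘ there)
  ... | inj₂ (_ , refl) = walk-stays-out-of-subtree p ¬anc-y (∉xs ∘ there)
    where
    ¬anc-y : ¬ Ancestor u y
    ¬anc-y self       = ∉xs (there (Walk-head∈ G p))
    ¬anc-y (up _ anc) = ¬anc anc

  private
    head∉ : ∀ {u : Fin n} {xs} → Unique (u ∷ xs) → u ∉ xs
    head∉ (u∉ ∷ _) = All¬⇒¬Any u∉

    -- w₁ is a child of u and w₂ another neighbour of u (last hypothesis); they cannot both reach v avoiding u.
    branches-disjoint : ∀ {u v w₁ w₂ xs₁ xs₂} → w₁ ≢ w₂ → w₁ ≢ root → parent w₁ ≡ u
                      → Walk G w₁ v xs₁ → u ∉ xs₁ → Walk G w₂ v xs₂ → u ∉ xs₂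
                      → (u ≢ root × parent u ≡ w₂) ⊎ (w₂ ≢ root × parent w₂ ≡ u) → ⊥
    branches-disjoint w₁≢w₂ w₁≢root refl p₁ u∉₁ p₂ u∉₂ (inj₁ (u≢root , refl)) =
      walk-stays-out-of-subtree p₂ (¬Ancestor-parent u≢root) u∉₂
        (Ancestor-parent w₁≢root (walk-stays-in-subtree p₁ self u∉₁))
    branches-disjoint {w₁ = w₁} {w₂} w₁≢w₂ w₁≢root refl p₁ u∉₁ p₂ u∉₂ (inj₂ (w₂≢root , pw₂))
      with Ancestor-total (walk-stays-in-subtree p₁ self u∉₁)
                          (walk-stays-in-subtree p₂ self (subst (_∉ _) (sym pw₂) u∉₂))
    ... | inj₁ self       = w₁≢w₂ refl
    ... | inj₁ (up _ anc) = ¬Ancestor-parent w₁≢root (subst (Ancestor w₁) pw₂ anc)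
    ... | inj₂ self       = w₁≢w₂ refl
    ... | inj₂ (up _ anc) = ¬Ancestor-parent w₂≢root (subst (Ancestor w₂) (sym pw₂) anc)

  path-unique : ∀ {u v xs ys} → IsPath G u v xs → IsPath G u v ys → xs ≡ ys
  path-unique (here , _) (here , _) = refl
  path-unique (here , _) (step _ q , uq) = ⊥-elim (head∉ uq (Walk-last∈ G q))
  path-unique (step _ p , uq) (here , _) = ⊥-elim (head∉ uq (Walk-last∈ G p))
  path-unique {u} (step {w = w₁} e₁ p₁ , uq₁) (step {w = w₂} e₂ p₂ , uq₂) with w₁ ≟ᶠ w₂
  path-unique {u} (step e₁ p₁ , _ ∷ uq₁) (step e₂ p₂ , _ ∷ uq₂) | yes refl =
    cong (u ∷_) (path-unique (p₁ , uq₁) (p₂ , uq₂))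
  ... | no w₁≢w₂ with adj⇒parent e₁ | adj⇒parent e₂
  ... | inj₁ (_ , refl) | inj₁ (_ , pu) = ⊥-elim (w₁≢w₂ pu)
  ... | inj₂ (w₁≢root , pw₁) | c =
    ⊥-elim (branches-disjoint w₁≢w₂ w₁≢root pw₁ p₁ (head∉ uq₁) p₂ (head∉ uq₂) c)
  ... | inj₁ c | inj₂ (w₂≢root , pw₂) =
    ⊥-elim (branches-disjoint (w₁≢w₂ ∘ sym) w₂≢root pw₂ p₂ (head∉ uq₂) p₁ (head∉ uq₁) (inj₁ c))

  path-exists : ∀ u v → ∃ (IsPath G u v)
  path-exists u v =
    let _ , u⇝root = walkToRoot (suc (rank u)) u ≤-refl
        _ , v⇝root = walkToRoot (suc (rank v)) v ≤-refl
        _ , root⇝v , _ = Walk-reverse G v⇝root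
        _ , u⇝v = Walk-++ G u⇝root root⇝v
        ys , path , _ = Walk⇒Path G u⇝v
    in ys , path

  ParentStructure⇒IsTree : IsTree G
  ParentStructure⇒IsTree = nonempty root , path-exists , λ _ _ _ _ → path-unique
    where
    nonempty : ∀ {m} → Fin m → 0 < m
    nonempty Fin.zero    = s≤s z≤n
    nonempty (Fin.suc _) = s≤s z≤n

-- Rooting a tree at a vertex or at an edge

module RootedTree {n : ℕ} {G : Graph n} (tree : IsTree G) (r : Fin n) where
  open import Data.List.Membership.DecPropositional (_≟ᶠ_ {n}) using (_∈?_)

  pathToRoot : Fin n → List (Fin n)
  pathToRoot x = proj₁ (proj₁ (proj₂ tree) x r)

  pathToRoot-isPath : ∀ x → IsPath G x r (pathToRoot x)
  pathToRoot-isPath x = proj₂ (proj₁ (proj₂ tree) x r)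

  height : Fin n → ℕ
  height x = length (pathToRoot x)

  -- Junk value r at x = r.
  parent : Fin n → Fin n
  parent x = second (pathToRoot x)
    where
    second : List (Fin n) → Fin n
    second (_ ∷ w ∷ _) = w
    second _           = r

  IsPath⇒height : ∀ {x xs} → IsPath G x r xs → height x ≡ length xs
  IsPath⇒height {x} path = cong length (proj₂ (proj₂ tree) x r _ _ (pathToRoot-isPath x) path)

  Walk⇒height≤ : ∀ {x xs} → Walk G x r xs → height x ≤ length xs
  Walk⇒height≤ w = let _ , path , l = Walk⇒Path G w in subst (_≤ _) (sym (IsPath⇒height path)) l

  Walk-from-root⇒height≤ : ∀ {x xs} → Walk G r x xs → height x ≤ length xs
  Walk-from-root⇒height≤ w = let _ , w′ , l = Walk-reverse G w in subst (_ ≤_) l (Walk⇒height≤ w′)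

  height-adj : ∀ x y → adj G x y ≡ true → height y ≤ suc (height x)
  height-adj x y e = Walk⇒height≤ (step (adj-sym G e) (proj₁ (pathToRoot-isPath x)))

  height-root : height r ≤ 1
  height-root = Walk⇒height≤ here

  private
    pathToRoot-view : ∀ x → x ≢ r → Σ (List (Fin n)) λ ys
                    → pathToRoot x ≡ x ∷ ys × adj G x (parent x) ≡ true × IsPath G (parent x) r ys
    pathToRoot-view x x≢r with pathToRoot x | pathToRoot-isPath x
    ... | _ | here , _                      = ⊥-elim (x≢r refl)
    ... | _ | step e here , _ ∷ uq          = _ , refl , e , here , uq
    ... | _ | step e (step e′ p) , _ ∷ uq   = _ , refl , e , step e′ p , uq

  adj-parent : ∀ x → x ≢ r → adj G x (parent x) ≡ true
  adj-parent x x≢r = proj₁ (proj₂ (proj₂ (pathToRoot-view x x≢r)))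

  height-parent : ∀ x → x ≢ r → suc (height (parent x)) ≡ height x
  height-parent x x≢r =
    let _ , eq , _ , path = pathToRoot-view x x≢r
    in trans (cong suc (IsPath⇒height path)) (cong length (sym eq))

  ∈pathToRoot⇒height< : ∀ {x y} → y ∈ pathToRoot x → y ≢ x → height y < height x
  ∈pathToRoot⇒height< {x} {y} y∈ y≢x with pathToRoot x | pathToRoot-isPath x
  ... | _ | here , _ = ⊥-elim (y≢x (∈-singleton y∈))
    where
    ∈-singleton : ∀ {z} → y ∈ z ∷ [] → y ≡ z
    ∈-singleton (here eq) = eq
  ... | _ | step _ p , _ ∷ uq with y∈
  ...   | here y≡x = ⊥-elim (y≢x y≡x)
  ...   | there y∈tail = let _ , path , l = Path-suffix G p uq y∈tail
                         in s≤s (subst (_≤ _) (sym (IsPath⇒height path)) l)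

  private
    adj-∉pathToRoot⇒parent : ∀ {x y} → adj G x y ≡ true → y ∉ pathToRoot x → y ≢ r × parent y ≡ x
    adj-∉pathToRoot⇒parent {x} {y} e y∉ = y≢r , parent≡x
      where
      y≢r : y ≢ r
      y≢r refl = y∉ (Walk-last∈ G (proj₁ (pathToRoot-isPath x)))
      x⇝r : Walk G x r (pathToRoot x)
      x⇝r = proj₁ (pathToRoot-isPath x)
      extended : IsPath G y r (y ∷ pathToRoot x)
      extended = step (adj-sym G e) x⇝r , ¬Any⇒All¬ _ y∉ ∷ proj₂ (pathToRoot-isPath x)
      parent≡x : parent y ≡ x
      parent≡x =
        let _ , eq , _ , (parent⇝r , _) = pathToRoot-view y y≢r
            eq′ = proj₂ (proj₂ tree) y r _ _ (pathToRoot-isPath y) extended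
        in Walk-sources-agree G parent⇝r (subst (Walk G x r) (sym (∷-injectiveʳ (trans (sym eq) eq′))) x⇝r)

  adj⇒parent : ∀ {x y} → adj G x y ≡ true → (x ≢ r × parent x ≡ y) ⊎ (y ≢ r × parent y ≡ x)
  adj⇒parent {x} {y} e with y ∈? pathToRoot x | x ∈? pathToRoot y
  ... | no y∉ | _     = inj₂ (adj-∉pathToRoot⇒parent e y∉)
  ... | yes _ | no x∉ = inj₁ (adj-∉pathToRoot⇒parent (adj-sym G e) x∉)
  ... | yes y∈ | yes x∈ =
    ⊥-elim (<-asym (∈pathToRoot⇒height< y∈ (adj⇒≢ G e ∘ sym)) (∈pathToRoot⇒height< x∈ (adj⇒≢ G e)))

  Dist⇒height : ∀ {x d} → Dist G r x d → height x ≡ suc d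
  Dist⇒height {x} ((xs , w , l) , minimal) with Walk-reverse G (proj₁ (pathToRoot-isPath x))
  ... | ys , w′ , l′ =
    ≤-antisym (subst (height x ≤_) l (Walk-from-root⇒height≤ w)) (subst (_ ≤_) l′ (minimal ys w′))

  height⇒Dist : ∀ x → Σ ℕ λ d → Dist G r x d × height x ≡ suc d
  height⇒Dist x with Walk-reverse G (proj₁ (pathToRoot-isPath x))
  ... | [] , w , _ = ⊥-elim (Walk-nonempty G w)
  ... | y ∷ ys , w , l =
    length ys , ((y ∷ ys , w , refl) , λ zs w′ → subst (_≤ length zs) (sym l) (Walk-from-root⇒height≤ w′)) , sym l

  rootedAt : ParentStructure G
  rootedAt = record
    { root        = r
    ; parent      = parent
    ; rank        = height
    ; rank-parent = λ x x≢r → ≤-reflexive (height-parent x x≢r)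
    ; adj-parent  = adj-parent
    ; adj⇒parent  = adj⇒parent
    }

reRank : ∀ {n} {G : Graph n} (S : ParentStructure G) (f : Fin n → ℕ)
       → (∀ x → x ≢ ParentStructure.root S → f (ParentStructure.parent S x) < f x) → ParentStructure G
reRank S f f-parent = record { ParentStructure S ; rank = f ; rank-parent = f-parent }

module EdgeRootedTree {n : ℕ} {G : Graph n} (tree : IsTree G) {r₁ r₂ : Fin n} (r₁r₂∈ : adj G r₁ r₂ ≡ true) where
  module R (r : Fin n) = RootedTree tree r

  private
    near-root-bounds : ∀ {s t x L} → adj G s t ≡ true → Dist G s x L → (∀ d′ → Dist G t x d′ → L ≤ d′)
                     → R.height s x ≡ suc L × suc L ≤ R.height t x × R.height t x ≤ 2 + L
    near-root-bounds {s} {t} {x} {L} st∈ dist-s@((xs , s⇝x , len) , _) minimal = R.Dist⇒height s dist-s , lower , upper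
      where
      lower : suc L ≤ R.height t x
      lower = let d′ , dist-t , eq = R.height⇒Dist t x in subst (suc L ≤_) (sym eq) (s≤s (minimal d′ dist-t))
      upper : R.height t x ≤ 2 + L
      upper = ≤-pred (begin
        suc (R.height t x)       ≤⟨ Walk-length-Lipschitz G (R.height t) (R.height-adj t) s⇝x ⟩
        R.height t s + length xs ≡⟨ cong (R.height t s +_) len ⟩
        R.height t s + suc L     ≤⟨ +-monoˡ-≤ (suc L) (R.height-adj t t s (adj-sym G st∈)) ⟩
        suc (R.height t t) + suc L ≤⟨ +-monoˡ-≤ (suc L) (s≤s (R.height-root t)) ⟩
        2 + suc L                ∎)
        where open ≤-Reasoning

    lower-bound : ∀ L a b → suc L ≤ a → suc L ≤ b → 3 * L + 3 ≤ 2 * a + b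
    lower-bound L a b L<a L<b = begin
      3 * L + 3             ≡⟨ 3L+3≡2[1+L]+[1+L] L ⟩
      2 * suc L + suc L     ≤⟨ +-mono-≤ (*-monoʳ-≤ 2 L<a) L<b ⟩
      2 * a + b             ∎
      where
      open ≤-Reasoning
      3L+3≡2[1+L]+[1+L] : ∀ L → 3 * L + 3 ≡ 2 * suc L + suc L
      3L+3≡2[1+L]+[1+L] = solve-∀

    upper-bound : ∀ L a b → a ≤ 2 + L → b ≤ 2 + L → a ≡ suc L ⊎ b ≡ suc L → 2 * a + b ≤ 3 * L + 5
    upper-bound L a b a≤ b≤ (inj₁ refl) = begin
      2 * suc L + b         ≤⟨ +-monoʳ-≤ (2 * suc L) b≤ ⟩
      2 * suc L + (2 + L)   ≤⟨ n≤1+n _ ⟩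
      suc (2 * suc L + (2 + L)) ≡⟨ 1+2[1+L]+[2+L]≡3L+5 L ⟩
      3 * L + 5             ∎
      where
      open ≤-Reasoning
      1+2[1+L]+[2+L]≡3L+5 : ∀ L → suc (2 * suc L + (2 + L)) ≡ 3 * L + 5
      1+2[1+L]+[2+L]≡3L+5 = solve-∀
    upper-bound L a b a≤ b≤ (inj₂ refl) = begin
      2 * a + suc L         ≤⟨ +-monoˡ-≤ (suc L) (*-monoʳ-≤ 2 a≤) ⟩
      2 * (2 + L) + suc L   ≡⟨ 2[2+L]+[1+L]≡3L+5 L ⟩
      3 * L + 5             ∎
      where
      open ≤-Reasoning
      2[2+L]+[1+L]≡3L+5 : ∀ L → 2 * (2 + L) + suc L ≡ 3 * L + 5
      2[2+L]+[1+L]≡3L+5 = solve-∀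

  -- Along the r₁-parent, height r₁ drops by one while height r₂ rises by at most one.
  rank : Fin n → ℕ
  rank x = 2 * R.height r₁ x + R.height r₂ x

  rank-parent : ∀ x → x ≢ r₁ → rank (R.parent r₁ x) < rank x
  rank-parent x x≢r₁ = begin-strict
    2 * h₁ p + h₂ p         ≤⟨ +-monoʳ-≤ (2 * h₁ p) (R.height-adj r₂ x p (R.adj-parent r₁ x x≢r₁)) ⟩
    2 * h₁ p + suc (h₂ x)   <⟨ ≤-reflexive (1+2a+[1+b]≡2[1+a]+b (h₁ p) (h₂ x)) ⟩
    2 * suc (h₁ p) + h₂ x   ≡⟨ cong (λ h → 2 * h + h₂ x) (R.height-parent r₁ x x≢r₁) ⟩
    2 * h₁ x + h₂ x         ∎
    where
    open ≤-Reasoning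
    h₁ h₂ : Fin n → ℕ
    h₁ = R.height r₁
    h₂ = R.height r₂
    p : Fin n
    p = R.parent r₁ x
    1+2a+[1+b]≡2[1+a]+b : ∀ a b → suc (2 * a + suc b) ≡ 2 * suc a + b
    1+2a+[1+b]≡2[1+a]+b = solve-∀

  edgeRootedAt : ParentStructure G
  edgeRootedAt = reRank (R.rootedAt r₁) rank rank-parent

  RootDist⇒rank-bounds : ∀ {x L} → RootDist G (edgeRoot r₁ r₂ r₁r₂∈) x L
                       → 3 * L + 3 ≤ rank x × rank x ≤ 3 * L + 5
  RootDist⇒rank-bounds (inj₁ (dist₁ , minimal₂)) =
    let h₁≡ , L<h₂ , h₂≤ = near-root-bounds r₁r₂∈ dist₁ minimal₂
    in lower-bound _ _ _ (≤-reflexive (sym h₁≡)) L<h₂ ,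
       upper-bound _ _ _ (≤-trans (≤-reflexive h₁≡) (n≤1+n _)) h₂≤ (inj₁ h₁≡)
  RootDist⇒rank-bounds (inj₂ (dist₂ , minimal₁)) =
    let h₂≡ , L<h₁ , h₁≤ = near-root-bounds (adj-sym G r₁r₂∈) dist₂ minimal₁
    in lower-bound _ _ _ L<h₁ (≤-reflexive (sym h₂≡)) ,
       upper-bound _ _ _ h₁≤ (≤-trans (≤-reflexive h₂≡) (n≤1+n _)) (inj₂ h₂≡)

rootStructure : ∀ {n} {T : Graph n} → IsTree T → Root T → ParentStructure T
rootStructure tree (vertexRoot r)   = RootedTree.rootedAt tree r
rootStructure tree (edgeRoot _ _ e) = EdgeRootedTree.edgeRootedAt tree e

RootDist-suc⇒rank< : ∀ {n} {T : Graph n} (tree : IsTree T) (ρ : Root T) {u v d}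
                   → RootDist T ρ u d → RootDist T ρ v (suc d)
                   → ParentStructure.rank (rootStructure tree ρ) u < ParentStructure.rank (rootStructure tree ρ) v
RootDist-suc⇒rank< tree (vertexRoot r) dist-u dist-v
  rewrite RootedTree.Dist⇒height tree r dist-u | RootedTree.Dist⇒height tree r dist-v = ≤-refl
RootDist-suc⇒rank< tree (edgeRoot _ _ e) {d = d} dist-u dist-v = begin-strict
  rank _      ≤⟨ proj₂ (RootDist⇒rank-bounds dist-u) ⟩
  3 * d + 5   <⟨ ≤-reflexive (1+[3d+5]≡3[1+d]+3 d) ⟩
  3 * suc d + 3 ≤⟨ proj₁ (RootDist⇒rank-bounds dist-v) ⟩
  rank _      ∎
  where
  open EdgeRootedTree tree e
  open ≤-Reasoning
  1+[3d+5]≡3[1+d]+3 : ∀ d → suc (3 * d + 5) ≡ 3 * suc d + 3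
  1+[3d+5]≡3[1+d]+3 = solve-∀

-- Adjacency matrices, edge sums and edge exchanges

∑-change-one : ∀ {n} {f g : Fin n → ℕ} (k : Fin n) {c} → (∀ j → j ≢ k → f j ≡ g j) → f k ≡ g k + c
             → ∑[ j < n ] f j ≡ ∑[ j < n ] g j + c
∑-change-one {suc _} {f} {g} k {c} agree fk≡ = begin
  ∑[ j < _ ] f j                         ≡⟨ sum-remove f ⟩
  f k + ∑[ j < _ ] f (Fin.punchIn k j)   ≡⟨ cong₂ _+_ fk≡ (sum-cong-≗ λ j → agree _ (punchInᵢ≢i k j)) ⟩
  g k + c + ∑[ j < _ ] g (Fin.punchIn k j) ≡⟨ xy∙z≈xz∙y (g k) c _ ⟩
  g k + ∑[ j < _ ] g (Fin.punchIn k j) + c ≡⟨ cong (_+ c) (sym (sum-remove g)) ⟩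
  ∑[ j < _ ] g j + c                     ∎
  where open ≡-Reasoning

AdjMatrix : ℕ → Set
AdjMatrix n = Fin n → Fin n → Bool

indicator : Bool → ℕ
indicator b = if b then 1 else 0

module _ {n : ℕ} where

  SameEdge : Fin n → Fin n → Fin n → Fin n → Set
  SameEdge k l i j = (i ≡ k × j ≡ l) ⊎ (i ≡ l × j ≡ k)

  SameEdge? : ∀ k l i j → Dec (SameEdge k l i j)
  SameEdge? k l i j = (i ≟ᶠ k ×-dec j ≟ᶠ l) ⊎-dec (i ≟ᶠ l ×-dec j ≟ᶠ k)

  SameEdge-flip : ∀ {k l i j} → SameEdge k l i j → SameEdge k l j i
  SameEdge-flip (inj₁ (i≡k , j≡l)) = inj₂ (j≡l , i≡k)
  SameEdge-flip (inj₂ (i≡l , j≡k)) = inj₁ (j≡k , i≡l)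

  SameEdge-swap : ∀ {k l i j} → SameEdge k l i j → SameEdge l k i j
  SameEdge-swap (inj₁ p) = inj₂ p
  SameEdge-swap (inj₂ p) = inj₁ p

  setEdge : Fin n → Fin n → Bool → AdjMatrix n → AdjMatrix n
  setEdge k l b M i j = if does (SameEdge? k l i j) then b else M i j

  setEdge-same : ∀ {k l i j b M} → SameEdge k l i j → setEdge k l b M i j ≡ b
  setEdge-same {k} {l} {i} {j} s rewrite dec-true (SameEdge? k l i j) s = refl

  setEdge-other : ∀ {k l i j b M} → ¬ SameEdge k l i j → setEdge k l b M i j ≡ M i j
  setEdge-other {k} {l} {i} {j} ns rewrite dec-false (SameEdge? k l i j) ns = refl

  SymmetricM : AdjMatrix n → Set
  SymmetricM M = ∀ i j → M i j ≡ M j i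

  IrreflexiveM : AdjMatrix n → Set
  IrreflexiveM M = ∀ i → M i i ≡ false

  setEdge-symmetric : ∀ {k l b M} → SymmetricM M → SymmetricM (setEdge k l b M)
  setEdge-symmetric {k} {l} {b} {M} sym-M i j with SameEdge? k l i j
  ... | yes s = trans (setEdge-same {M = M} s) (sym (setEdge-same {M = M} (SameEdge-flip s)))
  ... | no ns = trans (setEdge-other {M = M} ns) (trans (sym-M i j) (sym (setEdge-other {M = M} (ns ∘ SameEdge-flip))))

  setEdge-irreflexive : ∀ {k l b M} → k ≢ l → IrreflexiveM M → IrreflexiveM (setEdge k l b M)
  setEdge-irreflexive {k} {l} {b} {M} k≢l irr-M i with SameEdge? k l i i
  ... | yes (inj₁ (refl , i≡l)) = ⊥-elim (k≢l i≡l)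
  ... | yes (inj₂ (refl , i≡k)) = ⊥-elim (k≢l (sym i≡k))
  ... | no ns = trans (setEdge-other {M = M} ns) (irr-M i)

  SymmetricM-edge : ∀ {M k l i j b} → SymmetricM M → M k l ≡ b → SameEdge k l i j → M i j ≡ b
  SymmetricM-edge sym-M Mkl (inj₁ (refl , refl)) = Mkl
  SymmetricM-edge sym-M Mkl (inj₂ (refl , refl)) = trans (sym-M _ _) Mkl

  record EdgeRemoved (k l : Fin n) (M M′ : AdjMatrix n) : Set where
    field
      distinct : k ≢ l
      present  : ∀ {i j} → SameEdge k l i j → M i j ≡ true
      absent   : ∀ {i j} → SameEdge k l i j → M′ i j ≡ false
      agree    : ∀ i j → ¬ SameEdge k l i j → M i j ≡ M′ i j

  EdgeRemoved-swap : ∀ {k l M M′} → EdgeRemoved k l M M′ → EdgeRemoved l k M M′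
  EdgeRemoved-swap t = record
    { distinct = distinct ∘ sym
    ; present  = present ∘ SameEdge-swap
    ; absent   = absent ∘ SameEdge-swap
    ; agree    = λ i j ns → agree i j (ns ∘ SameEdge-swap)
    }
    where open EdgeRemoved t

  setEdge-removes : ∀ {k l M} → k ≢ l → SymmetricM M → M k l ≡ true → EdgeRemoved k l M (setEdge k l false M)
  setEdge-removes {M = M} k≢l sym-M Mkl = record
    { distinct = k≢l
    ; present  = SymmetricM-edge sym-M Mkl
    ; absent   = setEdge-same {M = M}
    ; agree    = λ i j ns → sym (setEdge-other {M = M} ns)
    }

  setEdge-adds : ∀ {k l M} → k ≢ l → SymmetricM M → M k l ≡ false → EdgeRemoved k l (setEdge k l true M) M
  setEdge-adds {M = M} k≢l sym-M Mkl = record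
    { distinct = k≢l
    ; present  = setEdge-same {M = M}
    ; absent   = SymmetricM-edge sym-M Mkl
    ; agree    = λ i j ns → setEdge-other {M = M} ns
    }

  edgeEntry : AdjMatrix n → (Fin n → Fin n → ℕ) → Fin n → Fin n → ℕ
  edgeEntry M w i j = if (toℕ i <ᵇ toℕ j) ∧ M i j then w i j else 0

  edgeSum : AdjMatrix n → (Fin n → Fin n → ℕ) → ℕ
  edgeSum M w = ∑[ i < n ] ∑[ j < n ] edgeEntry M w i j

  edgeSum-cong : ∀ M {w w′ : Fin n → Fin n → ℕ} → (∀ i j → w i j ≡ w′ i j) → edgeSum M w ≡ edgeSum M w′
  edgeSum-cong M w≗w′ = sum-cong-≗ {n} λ i → sum-cong-≗ {n} λ j →
    cong (λ z → if (toℕ i <ᵇ toℕ j) ∧ M i j then z else 0) (w≗w′ i j)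

  degree : AdjMatrix n → Fin n → ℕ
  degree M v = ∑[ j < n ] indicator (M v j)

  endpoints : Fin n → Fin n → Fin n → ℕ
  endpoints k l v = indicator (does (v ≟ᶠ k)) + indicator (does (v ≟ᶠ l))

  EdgeAdditive : (AdjMatrix n → ℕ) → (Fin n → Fin n → ℕ) → Set
  EdgeAdditive F c = ∀ {k l M M′} → EdgeRemoved k l M M′ → F M ≡ F M′ + c k l

  private
    edgeSum-removal-< : ∀ {w k l M M′} → toℕ k < toℕ l → EdgeRemoved k l M M′
                      → edgeSum M w ≡ edgeSum M′ w + w k l
    edgeSum-removal-< {w} {k} {l} {M} {M′} k<l t =
      ∑-change-one k (λ i i≢k → sum-cong-≗ {n} λ j → entry-agree i j (i≢k ∘ proj₁))
        (∑-change-one l (λ j j≢l → entry-agree k j (j≢l ∘ proj₂)) entry-kl)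
      where
      open EdgeRemoved t
      k<ᵇl : (toℕ k <ᵇ toℕ l) ≡ true
      k<ᵇl = dec-true (toℕ k <? toℕ l) k<l
      l<ᵇk : (toℕ l <ᵇ toℕ k) ≡ false
      l<ᵇk = dec-false (toℕ l <? toℕ k) (<⇒≯ k<l)
      entry-kl : edgeEntry M w k l ≡ edgeEntry M′ w k l + w k l
      entry-kl rewrite k<ᵇl | present (inj₁ (refl , refl)) | absent (inj₁ (refl , refl)) = refl
      entry-agree : ∀ i j → ¬ (i ≡ k × j ≡ l) → edgeEntry M w i j ≡ edgeEntry M′ w i j
      entry-agree i j ≢kl with SameEdge? k l i j
      ... | yes (inj₁ i,j≡k,l) = ⊥-elim (≢kl i,j≡k,l)
      ... | yes (inj₂ (refl , refl)) rewrite l<ᵇk = refl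
      ... | no ns = cong (λ b → if (toℕ i <ᵇ toℕ j) ∧ b then w i j else 0) (agree i j ns)

  edgeSum-edgeAdditive : ∀ {w} → (∀ i j → w i j ≡ w j i) → EdgeAdditive (λ M → edgeSum M w) w
  edgeSum-edgeAdditive {w} w-sym {k} {l} {M} {M′} t with <-cmp (toℕ k) (toℕ l)
  ... | tri< k<l _ _ = edgeSum-removal-< {w} k<l t
  ... | tri≈ _ k≡l _ = ⊥-elim (EdgeRemoved.distinct t (toℕ-injective k≡l))
  ... | tri> _ _ l<k = trans (edgeSum-removal-< {w} l<k (EdgeRemoved-swap t)) (cong (edgeSum M′ w +_) (w-sym l k))

  private
    ¬SameEdge : ∀ {k l i j} → i ≢ k ⊎ j ≢ l → i ≢ l ⊎ j ≢ k → ¬ SameEdge k l i j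
    ¬SameEdge (inj₁ i≢k) _ (inj₁ (i≡k , _)) = i≢k i≡k
    ¬SameEdge (inj₂ j≢l) _ (inj₁ (_ , j≡l)) = j≢l j≡l
    ¬SameEdge _ (inj₁ i≢l) (inj₂ (i≡l , _)) = i≢l i≡l
    ¬SameEdge _ (inj₂ j≢k) (inj₂ (_ , j≡k)) = j≢k j≡k

    removal-indicator-agree : ∀ {k l M M′} → EdgeRemoved k l M M′ → ∀ v j → ¬ SameEdge k l v j
                           → indicator (M v j) ≡ indicator (M′ v j)
    removal-indicator-agree t v j ns = cong indicator (EdgeRemoved.agree t v j ns)

    removal-indicator-edge : ∀ {k l M M′ v j} → EdgeRemoved k l M M′ → SameEdge k l v j
                          → indicator (M v j) ≡ indicator (M′ v j) + 1
    removal-indicator-edge t s rewrite EdgeRemoved.present t s | EdgeRemoved.absent t s = refl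

    degree-removal-source : ∀ {k l M M′} → EdgeRemoved k l M M′ → degree M k ≡ degree M′ k + 1
    degree-removal-source {k} {l} t =
      ∑-change-one l
        (λ j j≢l → removal-indicator-agree t k j (¬SameEdge (inj₂ j≢l) (inj₁ (EdgeRemoved.distinct t))))
        (removal-indicator-edge t (inj₁ (refl , refl)))

    degree-removal-other : ∀ {k l M M′ v} → EdgeRemoved k l M M′ → v ≢ k → v ≢ l → degree M v ≡ degree M′ v
    degree-removal-other {v = v} t v≢k v≢l =
      sum-cong-≗ {n} λ j → removal-indicator-agree t v j (¬SameEdge (inj₁ v≢k) (inj₁ v≢l))

  degree-edgeAdditive : ∀ v → EdgeAdditive (λ M → degree M v) (λ k l → endpoints k l v)
  degree-edgeAdditive v {k} {l} t with v ≟ᶠ k | v ≟ᶠ l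
  ... | yes refl | yes refl = ⊥-elim (EdgeRemoved.distinct t refl)
  ... | yes refl | no _     = degree-removal-source t
  ... | no _     | yes refl = degree-removal-source (EdgeRemoved-swap t)
  ... | no v≢k   | no v≢l   = trans (degree-removal-other t v≢k v≢l) (sym (+-identityʳ _))

  module ExchangeStages (p a q b : Fin n) (M : AdjMatrix n) where
    M₁ M₂ M₃ M₄ : AdjMatrix n
    M₁ = setEdge p a false M
    M₂ = setEdge p b true M₁
    M₃ = setEdge q b false M₂
    M₄ = setEdge q a true M₃

  exchange : Fin n → Fin n → Fin n → Fin n → AdjMatrix n → AdjMatrix n
  exchange p a q b M = ExchangeStages.M₄ p a q b M

  record Exchangeable (M : AdjMatrix n) (p a q b : Fin n) : Set where
    field
      symmetric : SymmetricM M
      p≢q : p ≢ q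
      a≢b : a ≢ b
      p≢a : p ≢ a
      p≢b : p ≢ b
      q≢a : q ≢ a
      q≢b : q ≢ b
      pa∈ : M p a ≡ true
      qb∈ : M q b ≡ true
      pb∉ : M p b ≡ false
      qa∉ : M q a ≡ false

  exchange-symmetric : ∀ {p a q b M} → SymmetricM M → SymmetricM (exchange p a q b M)
  exchange-symmetric {p} {a} {q} {b} {M} sym-M =
    setEdge-symmetric {M = M₃} (setEdge-symmetric {M = M₂} (setEdge-symmetric {M = M₁} (setEdge-symmetric {M = M} sym-M)))
    where open ExchangeStages p a q b M

  exchange-irreflexive : ∀ {p a q b M} → Exchangeable M p a q b → IrreflexiveM M → IrreflexiveM (exchange p a q b M)
  exchange-irreflexive {p} {a} {q} {b} {M} ex irr-M =
    setEdge-irreflexive {M = M₃} q≢a (setEdge-irreflexive {M = M₂} q≢b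
      (setEdge-irreflexive {M = M₁} p≢b (setEdge-irreflexive {M = M} p≢a irr-M)))
    where
    open Exchangeable ex
    open ExchangeStages p a q b M

  exchange-additive : ∀ {F c M p a q b} → EdgeAdditive F c → Exchangeable M p a q b
                    → F (exchange p a q b M) + (c p a + c q b) ≡ F M + (c p b + c q a)
  exchange-additive {F} {c} {M} {p} {a} {q} {b} additive ex = begin
    F M₄ + (c p a + c q b)         ≡⟨ cong (_+ _) (additive removal-qa) ⟩
    F M₃ + c q a + (c p a + c q b) ≡⟨ rearrange (F M₃) (c q a) (c p a) (c q b) ⟩
    F M₃ + c q b + (c p a + c q a) ≡⟨ cong (_+ _) (sym (additive removal-qb)) ⟩
    F M₂ + (c p a + c q a)         ≡⟨ cong (_+ _) (additive removal-pb) ⟩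
    F M₁ + c p b + (c p a + c q a) ≡⟨ rearrange′ (F M₁) (c p b) (c p a) (c q a) ⟩
    F M₁ + c p a + (c p b + c q a) ≡⟨ cong (_+ _) (sym (additive removal-pa)) ⟩
    F M + (c p b + c q a)          ∎
    where
    open Exchangeable ex
    open ≡-Reasoning
    open ExchangeStages p a q b M
    rearrange : ∀ m x y z → m + x + (y + z) ≡ m + z + (y + x)
    rearrange = solve-∀
    rearrange′ : ∀ m x y z → m + x + (y + z) ≡ m + y + (x + z)
    rearrange′ = solve-∀
    off : ∀ {k l i j b} (N : AdjMatrix n) → i ≢ k ⊎ j ≢ l → i ≢ l ⊎ j ≢ k → setEdge k l b N i j ≡ N i j
    off N ne₁ ne₂ = setEdge-other {M = N} (¬SameEdge ne₁ ne₂)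
    removal-pa : EdgeRemoved p a M M₁
    removal-pa = setEdge-removes p≢a symmetric pa∈
    removal-pb : EdgeRemoved p b M₂ M₁
    removal-pb = setEdge-adds p≢b (setEdge-symmetric symmetric)
      (trans (off M (inj₂ (a≢b ∘ sym)) (inj₁ p≢a)) pb∉)
    removal-qb : EdgeRemoved q b M₂ M₃
    removal-qb = setEdge-removes q≢b (setEdge-symmetric (setEdge-symmetric symmetric))
      (trans (off M₁ (inj₁ (p≢q ∘ sym)) (inj₁ q≢b)) (trans (off M (inj₁ (p≢q ∘ sym)) (inj₁ q≢a)) qb∈))
    removal-qa : EdgeRemoved q a M₄ M₃
    removal-qa = setEdge-adds q≢a (setEdge-symmetric (setEdge-symmetric (setEdge-symmetric symmetric)))
      (trans (off M₂ (inj₂ a≢b) (inj₁ q≢b))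
        (trans (off M₁ (inj₁ (p≢q ∘ sym)) (inj₁ q≢b)) (trans (off M (inj₁ (p≢q ∘ sym)) (inj₁ q≢a)) qa∉)))

  module ExchangeEntries (p a q b : Fin n) (M : AdjMatrix n) {i j : Fin n} where
    open ExchangeStages p a q b M

    exchange-added-qa : SameEdge q a i j → exchange p a q b M i j ≡ true
    exchange-added-qa = setEdge-same {M = M₃}

    exchange-added-pb : SameEdge p b i j → ¬ SameEdge q b i j → exchange p a q b M i j ≡ true
    exchange-added-pb pb ¬qb with SameEdge? q a i j
    ... | yes qa  = setEdge-same {M = M₃} qa
    ... | no ¬qa = trans (setEdge-other {M = M₃} ¬qa) (trans (setEdge-other {M = M₂} ¬qb) (setEdge-same {M = M₁} pb))

    exchange-removed : SameEdge p a i j ⊎ SameEdge q b i j → ¬ SameEdge p b i j → ¬ SameEdge q a i j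
                     → exchange p a q b M i j ≡ false
    exchange-removed pa∨qb ¬pb ¬qa with SameEdge? q b i j | pa∨qb
    ... | yes qb  | _        = trans (setEdge-other {M = M₃} ¬qa) (setEdge-same {M = M₂} qb)
    ... | no ¬qb | inj₂ qb  = ⊥-elim (¬qb qb)
    ... | no ¬qb | inj₁ pa  =
      trans (setEdge-other {M = M₃} ¬qa)
        (trans (setEdge-other {M = M₂} ¬qb) (trans (setEdge-other {M = M₁} ¬pb) (setEdge-same {M = M} pa)))

    exchange-outside : ¬ SameEdge p a i j → ¬ SameEdge p b i j → ¬ SameEdge q b i j → ¬ SameEdge q a i j
                     → exchange p a q b M i j ≡ M i j
    exchange-outside ¬pa ¬pb ¬qb ¬qa =
      trans (setEdge-other {M = M₃} ¬qa)
        (trans (setEdge-other {M = M₂} ¬qb) (trans (setEdge-other {M = M₁} ¬pb) (setEdge-other {M = M} ¬pa)))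

-- The Sombor floor sum as an edge sum

module _ {A B : Set} where

  sumˡ-map-concatMap : ∀ (f : B → ℕ) (g : A → List B) xs
                     → sumˡ (map f (concatMap g xs)) ≡ sumˡ (map (λ x → sumˡ (map f (g x))) xs)
  sumˡ-map-concatMap f g []       = refl
  sumˡ-map-concatMap f g (x ∷ xs) = begin
    sumˡ (map f (g x ++ concatMap g xs))                ≡⟨ cong sumˡ (map-++ f (g x) _) ⟩
    sumˡ (map f (g x) ++ map f (concatMap g xs))        ≡⟨ sum-++ (map f (g x)) _ ⟩
    sumˡ (map f (g x)) + sumˡ (map f (concatMap g xs))  ≡⟨ cong (_ +_) (sumˡ-map-concatMap f g xs) ⟩
    sumˡ (map f (g x)) + sumˡ (map (λ x → sumˡ (map f (g x))) xs) ∎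
    where open ≡-Reasoning

module _ {A : Set} where

  sumˡ-map-filterᵇ : ∀ (f : A → ℕ) (P : A → Bool) xs
                   → sumˡ (map f (filterᵇ P xs)) ≡ sumˡ (map (λ x → if P x then f x else 0) xs)
  sumˡ-map-filterᵇ f P [] = refl
  sumˡ-map-filterᵇ f P (x ∷ xs) with P x
  ... | true  = cong (f x +_) (sumˡ-map-filterᵇ f P xs)
  ... | false = sumˡ-map-filterᵇ f P xs

  length-filterᵇ : ∀ (P : A → Bool) xs → length (filterᵇ P xs) ≡ sumˡ (map (indicator ∘ P) xs)
  length-filterᵇ P [] = refl
  length-filterᵇ P (x ∷ xs) with P x
  ... | true  = cong suc (length-filterᵇ P xs)
  ... | false = length-filterᵇ P xs

  sumˡ-map-tabulate : ∀ {n} (f : A → ℕ) (g : Fin n → A) → sumˡ (map f (tabulate g)) ≡ ∑[ i < n ] f (g i)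
  sumˡ-map-tabulate {zero}  f g = refl
  sumˡ-map-tabulate {suc n} f g = cong (f (g Fin.zero) +_) (sumˡ-map-tabulate f (g ∘ Fin.suc))

sumˡ-map-allFin : ∀ {n} (f : Fin n → ℕ) → sumˡ (map f (allFin n)) ≡ ∑[ i < n ] f i
sumˡ-map-allFin f = sumˡ-map-tabulate f id

module _ {n : ℕ} where

  pairsWhere : (Fin n → Fin n → Bool) → List (Fin n × Fin n)
  pairsWhere P = concatMap (λ i → map (i ,_) (filterᵇ (P i) (allFin n))) (allFin n)

  sumˡ-map-pairsWhere : ∀ (P : Fin n → Fin n → Bool) (f : Fin n × Fin n → ℕ)
                      → sumˡ (map f (pairsWhere P)) ≡ ∑[ i < n ] ∑[ j < n ] (if P i j then f (i , j) else 0)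
  sumˡ-map-pairsWhere P f = begin
    sumˡ (map f (pairsWhere P))
      ≡⟨ sumˡ-map-concatMap f _ (allFin n) ⟩
    sumˡ (map (λ i → sumˡ (map f (map (i ,_) (filterᵇ (P i) (allFin n))))) (allFin n))
      ≡⟨ sumˡ-map-allFin (λ i → sumˡ (map f (map (i ,_) (filterᵇ (P i) (allFin n))))) ⟩
    ∑[ i < n ] sumˡ (map f (map (i ,_) (filterᵇ (P i) (allFin n))))
      ≡⟨ sum-cong-≗ {n} (λ i → row i) ⟩
    ∑[ i < n ] ∑[ j < n ] (if P i j then f (i , j) else 0) ∎
    where
    open ≡-Reasoning
    row : ∀ i → sumˡ (map f (map (i ,_) (filterᵇ (P i) (allFin n)))) ≡ ∑[ j < n ] (if P i j then f (i , j) else 0)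
    row i = begin
      sumˡ (map f (map (i ,_) (filterᵇ (P i) (allFin n)))) ≡⟨ cong sumˡ (sym (map-∘ (filterᵇ (P i) (allFin n)))) ⟩
      sumˡ (map (f ∘ (i ,_)) (filterᵇ (P i) (allFin n)))   ≡⟨ sumˡ-map-filterᵇ (f ∘ (i ,_)) (P i) (allFin n) ⟩
      sumˡ (map (λ j → if P i j then f (i , j) else 0) (allFin n))
        ≡⟨ sumˡ-map-allFin (λ j → if P i j then f (i , j) else 0) ⟩
      ∑[ j < n ] (if P i j then f (i , j) else 0)           ∎

scaledNorm : ℕ → ℕ → ℕ → ℕ
scaledNorm N x y = isqrt (N * N * (x * x + y * y))

soWeight : ∀ {n} → ℕ → (Fin n → ℕ) → Fin n → Fin n → ℕ
soWeight N d i j = scaledNorm N (d i) (d j)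

module _ {n : ℕ} (G : Graph n) where

  deg≡degree : ∀ v → deg G v ≡ degree (adj G) v
  deg≡degree v = trans (length-filterᵇ (adj G v) (allFin n)) (sumˡ-map-allFin (indicator ∘ adj G v))

  -- Defs.edges filters with a conjunction local to its where-clause; its predicate is recovered by unification.
  private
    edges-shape : Σ (Fin n → Fin n → Bool) λ P → edges G ≡ pairsWhere P
    edges-shape = _ , refl

    edgePredicate-spec : ∀ i j → proj₁ edges-shape i j ≡ (toℕ i <ᵇ toℕ j) ∧ adj G i j
    edgePredicate-spec i j with toℕ i <ᵇ toℕ j
    ... | true  = refl
    ... | false = refl

  scaledFloorSum≡edgeSum : ∀ N → scaledFloorSum N (somborTerms G) ≡ edgeSum (adj G) (soWeight N (deg G))
  scaledFloorSum≡edgeSum N = begin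
    sumˡ (map g (map term (edges G)))    ≡⟨ cong sumˡ (sym (map-∘ (edges G))) ⟩
    sumˡ (map (g ∘ term) (edges G))      ≡⟨ cong (λ es → sumˡ (map (g ∘ term) es)) (proj₂ edges-shape) ⟩
    sumˡ (map (g ∘ term) (pairsWhere _)) ≡⟨ sumˡ-map-pairsWhere _ (g ∘ term) ⟩
    ∑[ i < n ] ∑[ j < n ] (if proj₁ edges-shape i j then g (term (i , j)) else 0)
      ≡⟨ sum-cong-≗ {n} (λ i → sum-cong-≗ {n} λ j →
           cong (λ b → if b then g (term (i , j)) else 0) (edgePredicate-spec i j)) ⟩
    edgeSum (adj G) (soWeight N (deg G)) ∎
    where
    open ≡-Reasoning
    g : ℕ → ℕ
    g x = isqrt (N * N * x)
    term : Fin n × Fin n → ℕ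
    term (i , j) = deg G i * deg G i + deg G j * deg G j

-- Integer square roots and the gain of an exchange

private
  isqrtAux-lower : ∀ k m → isqrtAux k m * isqrtAux k m ≤ m
  isqrtAux-lower zero    m = z≤n
  isqrtAux-lower (suc k) m with suc k * suc k ≤ᵇ m in eq
  ... | true  = ≤ᵇ⇒≤ (suc k * suc k) m (subst T (sym eq) _)
  ... | false = isqrtAux-lower k m

  isqrtAux-upper : ∀ k m → m < suc k * suc k → m < suc (isqrtAux k m) * suc (isqrtAux k m)
  isqrtAux-upper zero    m m<1 = m<1
  isqrtAux-upper (suc k) m m<k² with suc k * suc k ≤ᵇ m in eq
  ... | true  = m<k²
  ... | false = isqrtAux-upper k m (≰⇒> λ k²≤m → subst T eq (≤⇒≤ᵇ k²≤m))

isqrt-lower : ∀ m → isqrt m * isqrt m ≤ m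
isqrt-lower m = isqrtAux-lower m m

isqrt-upper : ∀ m → m < suc (isqrt m) * suc (isqrt m)
isqrt-upper m = isqrtAux-upper m m (≤-trans (n<1+n m) (m≤m*n (suc m) (suc m)))

m*m≤n*n⇒m≤n : ∀ {m n} → m * m ≤ n * n → m ≤ n
m*m≤n*n⇒m≤n {m} {n} m²≤n² with m ≤? n
... | yes m≤n = m≤n
... | no m≰n  = ⊥-elim (<⇒≱ (*-mono-< (≰⇒> m≰n) (≰⇒> m≰n)) m²≤n²)

m≤t*t⇒isqrt≤t : ∀ {m t} → m ≤ t * t → isqrt m ≤ t
m≤t*t⇒isqrt≤t {m} m≤t² = m*m≤n*n⇒m≤n (≤-trans (isqrt-lower m) m≤t²)

-- Below, u, v play ⌊√(sU)⌋, ⌊√(sV)⌋ and x, y play ⌊√(sX)⌋ + 1, ⌊√(sY)⌋ + 1.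
module _ {s X Y U V u v x y : ℕ}
         (u-lower : u * u ≤ s * U) (v-lower : v * v ≤ s * V)
         (x-upper : s * X < x * x) (y-upper : s * Y < y * y) where

  ceiling-product-bound : ∀ {c} → X + Y ≡ U + V → x + y ≤ u + v + c → x * y ≤ u * v + (c * (u + v) + c * c)
  ceiling-product-bound {c} X+Y≡U+V x+y≤ =
    *-cancelˡ-≤ 2 (≤-trans (m≤n+m (2 * (x * y)) 2) (+-cancelˡ-≤ (s * X + s * Y) _ _ chain))
    where
    open ≤-Reasoning
    E : ℕ
    E = c * (u + v) + c * c
    sX+sY≡sU+sV : s * X + s * Y ≡ s * U + s * V
    sX+sY≡sU+sV = trans (sym (*-distribˡ-+ s X Y)) (trans (cong (s *_) X+Y≡U+V) (*-distribˡ-+ s U V))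
    square-sum : ∀ a b → (a + b) * (a + b) ≡ a * a + b * b + 2 * (a * b)
    square-sum = solve-∀
    square-sum₃ : ∀ a b c → (a + b + c) * (a + b + c) ≡ a * a + b * b + (2 * (a * b) + 2 * (c * (a + b)) + c * c)
    square-sum₃ = solve-∀
    shuffle : ∀ a b w → a + b + (2 + 2 * w) ≡ suc a + suc b + 2 * w
    shuffle = solve-∀
    double : ∀ a b c → 2 * a + 2 * b + 2 * c ≡ 2 * (a + (b + c))
    double = solve-∀
    chain : s * X + s * Y + (2 + 2 * (x * y)) ≤ s * X + s * Y + 2 * (u * v + E)
    chain = begin
      s * X + s * Y + (2 + 2 * (x * y))            ≡⟨ shuffle (s * X) (s * Y) (x * y) ⟩
      suc (s * X) + suc (s * Y) + 2 * (x * y)      ≤⟨ +-monoˡ-≤ _ (+-mono-≤ x-upper y-upper) ⟩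
      x * x + y * y + 2 * (x * y)                  ≡⟨ sym (square-sum x y) ⟩
      (x + y) * (x + y)                            ≤⟨ *-mono-≤ x+y≤ x+y≤ ⟩
      (u + v + c) * (u + v + c)                    ≡⟨ square-sum₃ u v c ⟩
      u * u + v * v + (2 * (u * v) + 2 * (c * (u + v)) + c * c)
        ≤⟨ +-mono-≤ (+-mono-≤ u-lower v-lower) (+-monoʳ-≤ (2 * (u * v) + 2 * (c * (u + v))) (m≤n*m (c * c) 2)) ⟩
      s * U + s * V + (2 * (u * v) + 2 * (c * (u + v)) + 2 * (c * c))
        ≡⟨ cong₂ _+_ (sym sX+sY≡sU+sV) (double (u * v) (c * (u + v)) (c * c)) ⟩
      s * X + s * Y + 2 * (u * v + E)              ∎

  product-gap : suc (U * V) ≤ X * Y → s * s + (u * v) * (u * v) ≤ (x * y) * (x * y)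
  product-gap UV<XY = begin
    s * s + (u * v) * (u * v)       ≡⟨ cong (s * s +_) (interchange u v u v) ⟩
    s * s + (u * u) * (v * v)       ≤⟨ +-monoʳ-≤ (s * s) (*-mono-≤ u-lower v-lower) ⟩
    s * s + (s * U) * (s * V)       ≡⟨ factor s U V ⟩
    s * s * suc (U * V)             ≤⟨ *-monoʳ-≤ (s * s) UV<XY ⟩
    s * s * (X * Y)                 ≡⟨ interchange s s X Y ⟩
    (s * X) * (s * Y)               ≤⟨ *-mono-≤ (<⇒≤ x-upper) (<⇒≤ y-upper) ⟩
    (x * x) * (y * y)               ≡⟨ interchange x x y y ⟩
    (x * y) * (x * y)               ∎
    where
    open ≤-Reasoning
    open *-Semigroup using (interchange)
    factor : ∀ s U V → s * s + (s * U) * (s * V) ≡ s * s * suc (U * V)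
    factor = solve-∀

  -- (xy)² − (uv)² ≥ s² while xy − uv is small, so s² is bounded by (xy − uv)(xy + uv).
  scale-bound : ∀ {c} → X + Y ≡ U + V → suc (U * V) ≤ X * Y → x + y ≤ u + v + c
              → s * s ≤ (c * (u + v) + c * c) * (x * y + u * v)
  scale-bound {c} X+Y≡U+V UV<XY x+y≤ = +-cancelʳ-≤ (uv * uv) _ _ (begin
    s * s + uv * uv              ≤⟨ product-gap UV<XY ⟩
    W * W                        ≤⟨ *-monoʳ-≤ W W≤ ⟩
    W * (uv + E)                 ≡⟨ *-distribˡ-+ W uv E ⟩
    W * uv + W * E               ≡⟨ cong (_+ W * E) (*-comm W uv) ⟩
    uv * W + W * E               ≤⟨ +-monoˡ-≤ (W * E) (*-monoʳ-≤ uv W≤) ⟩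
    uv * (uv + E) + W * E        ≡⟨ regroup uv E W ⟩
    E * (W + uv) + uv * uv       ∎)
    where
    open ≤-Reasoning
    uv W E : ℕ
    uv = u * v
    W = x * y
    E = c * (u + v) + c * c
    W≤ : W ≤ uv + E
    W≤ = ceiling-product-bound X+Y≡U+V x+y≤
    regroup : ∀ a e w → a * (a + e) + w * e ≡ e * (w + a) + a * a
    regroup = solve-∀

exchange-sums : ∀ P Q A B → (P * P + B * B) + (Q * Q + A * A) ≡ (P * P + A * A) + (Q * Q + B * B)
exchange-sums P Q A B = swap-ends (P * P) (B * B) (Q * Q) (A * A)
  where
  swap-ends : ∀ a b c d → (a + b) + (c + d) ≡ (a + d) + (c + b)
  swap-ends = solve-∀

exchange-products : ∀ {P Q A B} → Q < P → B < A
                  → suc ((P * P + A * A) * (Q * Q + B * B)) ≤ (P * P + B * B) * (Q * Q + A * A)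
exchange-products {Q = Q} {B = B} Q<P B<A with m≤n⇒∃[o]m+o≡n Q<P | m≤n⇒∃[o]m+o≡n B<A
... | s , refl | t , refl = begin
  suc UV                                                     ≡⟨ +-comm 1 UV ⟩
  UV + 1                                                     ≤⟨ +-monoʳ-≤ UV (s≤s z≤n) ⟩
  UV + (suc s * suc (2 * Q + s)) * (suc t * suc (2 * B + t)) ≡⟨ sym (XY≡UV+[P²−Q²][A²−B²] Q s B t) ⟩
  _                                                          ∎
  where
  open ≤-Reasoning
  UV : ℕ
  UV = ((suc Q + s) * (suc Q + s) + (suc B + t) * (suc B + t)) * (Q * Q + B * B)
  XY≡UV+[P²−Q²][A²−B²] : ∀ Q s B t → let P = suc Q + s ; A = suc B + t in
    (P * P + B * B) * (Q * Q + A * A)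
      ≡ (P * P + A * A) * (Q * Q + B * B) + (suc s * suc (2 * Q + s)) * (suc t * suc (2 * B + t))
  XY≡UV+[P²−Q²][A²−B²] = solve-∀

scaledNorm≤ : ∀ N a b → scaledNorm N a b ≤ N * (a + b)
scaledNorm≤ N a b = m≤t*t⇒isqrt≤t (begin
  N * N * (a * a + b * b)          ≤⟨ *-monoʳ-≤ (N * N) (m≤m+n (a * a + b * b) (2 * (a * b))) ⟩
  N * N * (a * a + b * b + 2 * (a * b)) ≡⟨ square N a b ⟩
  N * (a + b) * (N * (a + b))      ∎)
  where
  open ≤-Reasoning
  square : ∀ N a b → N * N * (a * a + b * b + 2 * (a * b)) ≡ N * (a + b) * (N * (a + b))
  square = solve-∀

[1+m+n]*m+n<[1+m+n]² : ∀ m n → let N = suc (m + n) in N * m + n < N * N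
[1+m+n]*m+n<[1+m+n]² m n = begin-strict
  N * m + n           <⟨ +-monoʳ-< (N * m) (s≤s (m≤n*m n N)) ⟩
  N * m + suc (N * n) ≤⟨ +-monoʳ-≤ (N * m) (+-monoˡ-≤ (N * n) 1≤N) ⟩
  N * m + (N + N * n) ≡⟨ regroup N m n ⟩
  N * N               ∎
  where
  open ≤-Reasoning
  N : ℕ
  N = suc (m + n)
  1≤N : 1 ≤ N
  1≤N = s≤s z≤n
  regroup : ∀ N m n → N * m + (N + N * n) ≡ N * suc (m + n)
  regroup = solve-∀

-- With X = P² + B², Y = Q² + A², U = P² + A², V = Q² + B², exchange-sums and exchange-products say
-- X + Y = U + V and XY > UV, whence √X + √Y > √U + √V.  If the floors at scale N were within K,
-- scale-bound would give N⁴ ≤ N²(N R₁ + R₂), all floors being at most N M; the choice of N rules this out.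
scaledNorm-exchange-gain : ∀ {P Q A B} (K : ℕ) → Q < P → B < A → ∃ λ N →
  scaledNorm N P A + scaledNorm N Q B + K < scaledNorm N P B + scaledNorm N Q A
scaledNorm-exchange-gain {P} {Q} {A} {B} K Q<P B<A = N , ≰⇒> (<⇒≱ ([1+m+n]*m+n<[1+m+n]² R₁ R₂) ∘ scale-bounded)
  where
  M c R₁ R₂ N X Y U V x y u v NM : ℕ
  M = P + A
  c = K + 2
  R₁ = 10 * c * M * M * M
  R₂ = 5 * c * c * M * M
  N = suc (R₁ + R₂)
  X = P * P + B * B
  Y = Q * Q + A * A
  U = P * P + A * A
  V = Q * Q + B * B
  x = scaledNorm N P B
  y = scaledNorm N Q A
  u = scaledNorm N P A
  v = scaledNorm N Q B
  NM = N * M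

  ≤NM : ∀ a b → a + b ≤ M → scaledNorm N a b ≤ NM
  ≤NM a b a+b≤M = ≤-trans (scaledNorm≤ N a b) (*-monoʳ-≤ N a+b≤M)

  scale-bounded : x + y ≤ u + v + K → N * N ≤ N * R₁ + R₂
  scale-bounded x+y≤ = *-cancelˡ-≤ (N * N) (begin
    (N * N) * (N * N)
      ≤⟨ scale-bound {N * N} {X} {Y} {U} {V} {u} {v} {suc x} {suc y}
                     (isqrt-lower (N * N * U)) (isqrt-lower (N * N * V)) (isqrt-upper (N * N * X)) (isqrt-upper (N * N * Y))
                     (exchange-sums P Q A B) (exchange-products Q<P B<A) x′+y′≤ ⟩
    (c * (u + v) + c * c) * (suc x * suc y + u * v)
      ≤⟨ *-mono-≤ (+-monoˡ-≤ (c * c) (*-monoʳ-≤ c (+-mono-≤ u≤ v≤)))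
                  (+-mono-≤ (*-mono-≤ (≤-trans (s≤s x≤) NM<2NM) (≤-trans (s≤s y≤) NM<2NM))
                            (*-mono-≤ u≤ v≤)) ⟩
    (c * (NM + NM) + c * c) * ((NM + NM) * (NM + NM) + NM * NM)
      ≡⟨ expand N M c ⟩
    (N * N) * (N * R₁ + R₂) ∎)
    where
    open ≤-Reasoning
    x≤ : x ≤ NM
    x≤ = ≤NM P B (+-monoʳ-≤ P (<⇒≤ B<A))
    y≤ : y ≤ NM
    y≤ = ≤NM Q A (+-monoˡ-≤ A (<⇒≤ Q<P))
    u≤ : u ≤ NM
    u≤ = ≤NM P A ≤-refl
    v≤ : v ≤ NM
    v≤ = ≤NM Q B (+-mono-≤ (<⇒≤ Q<P) (<⇒≤ B<A))
    shift : ∀ u v K → 2 + (u + v + K) ≡ u + v + (K + 2)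
    shift = solve-∀
    x′+y′≤ : suc x + suc y ≤ u + v + c
    x′+y′≤ = begin
      suc x + suc y     ≡⟨ +-suc (suc x) y ⟩
      2 + (x + y)       ≤⟨ +-monoʳ-≤ 2 x+y≤ ⟩
      2 + (u + v + K)   ≡⟨ shift u v K ⟩
      u + v + c         ∎
    NM<2NM : suc NM ≤ NM + NM
    NM<2NM = +-monoˡ-≤ NM (*-mono-≤ {1} {N} (s≤s z≤n) (≤-trans (s≤s z≤n) (≤-trans Q<P (m≤m+n P A))))
    expand : ∀ N M c → (c * (N * M + N * M) + c * c) * ((N * M + N * M) * (N * M + N * M) + (N * M) * (N * M))
                     ≡ (N * N) * (N * (10 * c * M * M * M) + 5 * c * c * M * M)
    expand = solve-∀

-- Exchanging children in an extremal tree

module TreeExchange {n : ℕ} {T : Graph n} (S : ParentStructure T) {p q a b : Fin n}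
  (pa∈ : adj T p a ≡ true) (qb∈ : adj T q b ≡ true)
  (p<a : ParentStructure.rank S p < ParentStructure.rank S a)
  (p<b : ParentStructure.rank S p < ParentStructure.rank S b)
  (q<a : ParentStructure.rank S q < ParentStructure.rank S a)
  (q<b : ParentStructure.rank S q < ParentStructure.rank S b)
  (p≢q : p ≢ q) (a≢b : a ≢ b) where

  open ParentStructure S
  open ParentStructureProperties S
  open ExchangeEntries p a q b (adj T)

  private
    rank<⇒≢ : ∀ {x y} → rank x < rank y → x ≢ y
    rank<⇒≢ x<y refl = <-irrefl refl x<y

    true≢false : true ≢ false
    true≢false ()

    parent-a : a ≢ root × parent a ≡ p
    parent-a = adj-rank<⇒parent pa∈ p<a

    parent-b : b ≢ root × parent b ≡ q
    parent-b = adj-rank<⇒parent qb∈ q<b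

    non-parent-¬adj : ∀ {x y z} → parent y ≡ z → z ≢ x → rank x < rank y → adj T x y ≡ false
    non-parent-¬adj {x} {y} py≡z z≢x x<y with adj T x y in e
    ... | false = refl
    ... | true  = ⊥-elim (z≢x (trans (sym py≡z) (proj₂ (adj-rank<⇒parent e x<y))))

  exchangeable : Exchangeable (adj T) p a q b
  exchangeable = record
    { symmetric = Graph.sym T
    ; p≢q = p≢q ; a≢b = a≢b
    ; p≢a = rank<⇒≢ p<a ; p≢b = rank<⇒≢ p<b ; q≢a = rank<⇒≢ q<a ; q≢b = rank<⇒≢ q<b
    ; pa∈ = pa∈ ; qb∈ = qb∈
    ; pb∉ = non-parent-¬adj (proj₂ parent-b) (p≢q ∘ sym) p<b
    ; qa∉ = non-parent-¬adj (proj₂ parent-a) p≢q q<a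
    }

  T′ : Graph n
  T′ = record
    { adj    = exchange p a q b (adj T)
    ; sym    = exchange-symmetric (Graph.sym T)
    ; irrefl = exchange-irreflexive exchangeable (Graph.irrefl T)
    }

  deg-exchange : ∀ v → deg T′ v ≡ deg T v
  deg-exchange v = begin
    deg T′ v                ≡⟨ deg≡degree T′ v ⟩
    degree (adj T′) v       ≡⟨ +-cancelʳ-≡ _ _ _ (trans (exchange-additive (degree-edgeAdditive v) exchangeable)
                                 (cong (degree (adj T) v +_) (swap-ends [ v ≟ᶠ p ] [ v ≟ᶠ b ] [ v ≟ᶠ q ] [ v ≟ᶠ a ]))) ⟩
    degree (adj T) v        ≡⟨ sym (deg≡degree T v) ⟩
    deg T v                 ∎
    where
    open ≡-Reasoning
    [_] : ∀ {x y : Fin n} → Dec (x ≡ y) → ℕ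
    [ x≟y ] = indicator (does x≟y)
    swap-ends : ∀ p b q a → (p + b) + (q + a) ≡ (p + a) + (q + b)
    swap-ends = solve-∀

  parent′ : Fin n → Fin n
  parent′ x with x ≟ᶠ a | x ≟ᶠ b
  ... | yes _ | _     = q
  ... | no _  | yes _ = p
  ... | no _  | no _  = parent x

  private
    parent′-a : parent′ a ≡ q
    parent′-a with a ≟ᶠ a
    ... | yes _   = refl
    ... | no a≢a = ⊥-elim (a≢a refl)

    parent′-b : parent′ b ≡ p
    parent′-b with b ≟ᶠ a | b ≟ᶠ b
    ... | yes b≡a | _      = ⊥-elim (a≢b (sym b≡a))
    ... | no _    | yes _  = refl
    ... | no _    | no b≢b = ⊥-elim (b≢b refl)

    parent′-other : ∀ {x} → x ≢ a → x ≢ b → parent′ x ≡ parent x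
    parent′-other {x} x≢a x≢b with x ≟ᶠ a | x ≟ᶠ b
    ... | yes x≡a | _       = ⊥-elim (x≢a x≡a)
    ... | no _    | yes x≡b = ⊥-elim (x≢b x≡b)
    ... | no _    | no _    = refl

    rank-parent′ : ∀ x → x ≢ root → rank (parent′ x) < rank x
    rank-parent′ x x≢root with x ≟ᶠ a | x ≟ᶠ b
    ... | yes refl | _        = q<a
    ... | no _     | yes refl = p<b
    ... | no _     | no _     = rank-parent x x≢root

    unmoved : ∀ {x y} → parent x ≡ y → ¬ SameEdge p a x y → ¬ SameEdge q b x y → x ≢ a × x ≢ b
    unmoved px≡y ¬pa ¬qb =
      (λ { refl → ¬pa (inj₂ (refl , trans (sym px≡y) (proj₂ parent-a))) }) ,
      (λ { refl → ¬qb (inj₂ (refl , trans (sym px≡y) (proj₂ parent-b))) })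

    parent-edge-kept : ∀ {x} → x ≢ root → x ≢ a → x ≢ b → exchange p a q b (adj T) x (parent x) ≡ true
    parent-edge-kept {x} x≢root x≢a x≢b = trans (exchange-outside ¬pa ¬pb ¬qb ¬qa) (adj-parent x x≢root)
      where
      px<x : rank (parent x) < rank x
      px<x = rank-parent x x≢root
      ¬pa : ¬ SameEdge p a x (parent x)
      ¬pa (inj₁ (refl , px≡a)) = <-asym p<a (subst (λ z → rank z < rank p) px≡a px<x)
      ¬pa (inj₂ (x≡a , _))    = x≢a x≡a
      ¬pb : ¬ SameEdge p b x (parent x)
      ¬pb (inj₁ (refl , px≡b)) = <-asym p<b (subst (λ z → rank z < rank p) px≡b px<x)
      ¬pb (inj₂ (x≡b , _))    = x≢b x≡b
      ¬qb : ¬ SameEdge q b x (parent x)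
      ¬qb (inj₁ (refl , px≡b)) = <-asym q<b (subst (λ z → rank z < rank q) px≡b px<x)
      ¬qb (inj₂ (x≡b , _))    = x≢b x≡b
      ¬qa : ¬ SameEdge q a x (parent x)
      ¬qa (inj₁ (refl , px≡a)) = <-asym q<a (subst (λ z → rank z < rank q) px≡a px<x)
      ¬qa (inj₂ (x≡a , _))    = x≢a x≡a

    moved? : ∀ x → x ≡ a ⊎ x ≡ b ⊎ (x ≢ a × x ≢ b)
    moved? x with x ≟ᶠ a | x ≟ᶠ b
    ... | yes x≡a | _       = inj₁ x≡a
    ... | no _    | yes x≡b = inj₂ (inj₁ x≡b)
    ... | no x≢a  | no x≢b  = inj₂ (inj₂ (x≢a , x≢b))

    adj-parent′ : ∀ x → x ≢ root → exchange p a q b (adj T) x (parent′ x) ≡ true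
    adj-parent′ x x≢root with moved? x
    ... | inj₁ refl =
      subst (λ z → exchange p a q b (adj T) a z ≡ true) (sym parent′-a) (exchange-added-qa (inj₂ (refl , refl)))
    ... | inj₂ (inj₁ refl) =
      subst (λ z → exchange p a q b (adj T) b z ≡ true) (sym parent′-b) (exchange-added-pb (inj₂ (refl , refl)) ¬qb)
      where
      ¬qb : ¬ SameEdge q b b p
      ¬qb (inj₁ (b≡q , _)) = rank<⇒≢ q<b (sym b≡q)
      ¬qb (inj₂ (_ , p≡q)) = p≢q p≡q
    ... | inj₂ (inj₂ (x≢a , x≢b)) =
      subst (λ z → exchange p a q b (adj T) x z ≡ true) (sym (parent′-other x≢a x≢b))
        (parent-edge-kept x≢root x≢a x≢b)

    adj⇒parent′ : ∀ {x y} → exchange p a q b (adj T) x y ≡ true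
                → (x ≢ root × parent′ x ≡ y) ⊎ (y ≢ root × parent′ y ≡ x)
    adj⇒parent′ {x} {y} e with SameEdge? q a x y
    ... | yes (inj₁ (refl , refl)) = inj₂ (proj₁ parent-a , parent′-a)
    ... | yes (inj₂ (refl , refl)) = inj₁ (proj₁ parent-a , parent′-a)
    ... | no ¬qa with SameEdge? p b x y
    ...   | yes (inj₁ (refl , refl)) = inj₂ (proj₁ parent-b , parent′-b)
    ...   | yes (inj₂ (refl , refl)) = inj₁ (proj₁ parent-b , parent′-b)
    ...   | no ¬pb with SameEdge? p a x y | SameEdge? q b x y
    ...     | yes pa | _      = ⊥-elim (true≢false (trans (sym e) (exchange-removed (inj₁ pa) ¬pb ¬qa)))
    ...     | no _   | yes qb = ⊥-elim (true≢false (trans (sym e) (exchange-removed (inj₂ qb) ¬pb ¬qa)))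
    ...     | no ¬pa | no ¬qb with adj⇒parent (trans (sym (exchange-outside ¬pa ¬pb ¬qb ¬qa)) e)
    ...       | inj₁ (x≢root , px≡y) = let x≢a , x≢b = unmoved px≡y ¬pa ¬qb
                                       in inj₁ (x≢root , trans (parent′-other x≢a x≢b) px≡y)
    ...       | inj₂ (y≢root , py≡x) = let y≢a , y≢b = unmoved py≡x (¬pa ∘ SameEdge-flip) (¬qb ∘ SameEdge-flip)
                                       in inj₂ (y≢root , trans (parent′-other y≢a y≢b) py≡x)

  T′-isTree : IsTree T′
  T′-isTree = ParentStructureProperties.ParentStructure⇒IsTree {G = T′} (record
    { root        = root
    ; parent      = parent′
    ; rank        = rank
    ; rank-parent = rank-parent′
    ; adj-parent  = adj-parent′
    ; adj⇒parent  = adj⇒parent′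
    })

  gain⇒¬SOle : ∀ N → let w = soWeight N (deg T) in
               w p a + w q b + length (somborTerms T) < w p b + w q a → ¬ SOle T′ T
  gain⇒¬SOle N gain T′≤T = <⇒≱ (+-cancelʳ-< (w p a + w q b) (F + K) F′ (begin-strict
    F + K + (w p a + w q b)   ≡⟨ regroup F K (w p a + w q b) ⟩
    F + (w p a + w q b + K)   <⟨ +-monoʳ-< F gain ⟩
    F + (w p b + w q a)       ≡⟨ sym edgeSum-exchange ⟩
    F′ + (w p a + w q b)      ∎))
    (subst₂ (λ x y → x ≤ y + K) SO-T′ (scaledFloorSum≡edgeSum T N) (T′≤T N))
    where
    open ≤-Reasoning
    w : Fin n → Fin n → ℕ
    w = soWeight N (deg T)
    K F F′ : ℕ
    K = length (somborTerms T)
    F = edgeSum (adj T) w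
    F′ = edgeSum (adj T′) w
    w-sym : ∀ i j → w i j ≡ w j i
    w-sym i j = cong (λ z → isqrt (N * N * z)) (+-comm (deg T i * deg T i) (deg T j * deg T j))
    regroup : ∀ a b c → a + b + c ≡ a + (c + b)
    regroup = solve-∀
    edgeSum-exchange : F′ + (w p a + w q b) ≡ F + (w p b + w q a)
    edgeSum-exchange =
      exchange-additive {F = λ M → edgeSum M w} {c = w} {M = adj T} {p} {a} {q} {b}
        (edgeSum-edgeAdditive {w = w} w-sym) exchangeable
    SO-T′ : scaledFloorSum N (somborTerms T′) ≡ F′
    SO-T′ = trans (scaledFloorSum≡edgeSum T′ N)
                  (edgeSum-cong (adj T′) {soWeight N (deg T′)} {w} λ i j →
                     cong₂ (scaledNorm N) (deg-exchange i) (deg-exchange j))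

  exchange-raises-SO : deg T q < deg T p → deg T b < deg T a → ¬ SOle T′ T
  exchange-raises-SO q<p b<a =
    let N , gain = scaledNorm-exchange-gain (length (somborTerms T)) q<p b<a in gain⇒¬SOle N gain

  degSeq-exchange : degSeq T′ ↭ degSeq T
  degSeq-exchange = ↭-reflexive (map-cong deg-exchange (allFin n))

no-improving-exchange : ∀ {n} {T : Graph n}
  → (∀ (T″ : Graph n) → IsTree T″ → degSeq T″ ↭ degSeq T → SOle T″ T)
  → (S : ParentStructure T) → let open ParentStructure S in
  ∀ {p q a b} → adj T p a ≡ true → adj T q b ≡ true
  → rank p < rank a → rank p < rank b → rank q < rank a → rank q < rank b
  → deg T q < deg T p → ¬ deg T b < deg T a
no-improving-exchange {T = T} maximal S pa∈ qb∈ p<a p<b q<a q<b q<p b<a =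
  exchange-raises-SO q<p b<a (maximal T′ T′-isTree degSeq-exchange)
  where
  open TreeExchange S pa∈ qb∈ p<a p<b q<a q<b (λ p≡q → <⇒≢ q<p (cong (deg T) (sym p≡q)))
                                              (λ a≡b → <⇒≢ b<a (cong (deg T) (sym a≡b)))

lemma3p8 : ∀ {n : ℕ} (T : Graph n) → IsTree T
    → (∀ (T″ : Graph n) → IsTree T″ → degSeq T″ ↭ degSeq T → SOle T″ T)
    → ∀ (ρ : Root T) (d : ℕ) (p q a b : Fin n)
    → RootDist T ρ p d → RootDist T ρ q d
    → deg T q < deg T p
    → adj T p a ≡ true → RootDist T ρ a (suc d)
    → adj T q b ≡ true → RootDist T ρ b (suc d)
    → deg T a ≤ deg T b
lemma3p8 T tree maximal ρ d p q a b dist-p dist-q q<p pa∈ dist-a qb∈ dist-b =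
  ≮⇒≥ (no-improving-exchange maximal S pa∈ qb∈
         (deeper dist-p dist-a) (deeper dist-p dist-b) (deeper dist-q dist-a) (deeper dist-q dist-b) q<p)
  where
  S : ParentStructure T
  S = rootStructure tree ρ
  deeper : ∀ {u v} → RootDist T ρ u d → RootDist T ρ v (suc d)
         → ParentStructure.rank S u < ParentStructure.rank S v
  deeper = RootDist-suc⇒rank< tree ρ
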